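{- Let $G=(V,E)$ be a simple graph on $n$ vertices with Tutte matrix $T$, and let $T'$ be an evaluation of $T$ in which the variable $x_i$ (for an edge $i\in E$) has value $a_i$. Suppose there is $a\in\{1,\dots,n^{10}\}$ with $\operatorname{rank} T'_{x_i\gets a}=\operatorname{rank} T'=k$, and suppose there is a vertex $u\in D(T'_{x_i\gets a})\setminus D(T')$. Then for every value $\tilde a\ne a_i$ we have $u\in D(T'_{x_i\gets\tilde a})$.
   Context: With $V=\{1,\dots,n\}$ and edge variables $x_e$ ($e\in E$), the Tutte matrix $T$ is the skew-symmetric matrix with $T_{uv}=x_e$ if $u<v$, $e=\{u,v\}\in E$; $T_{uv}=-x_e$ if $u>v$, $e=\{u,v\}\in E$; and $0$ otherwise. An evaluation of $T$ substitutes a rational value for every variable. For an evaluation $T'$, $T'_{x_i\gets a}$ is the matrix obtained by changing the value of $x_i$ to $a$. For a (skew-symmetric) matrix $M$ indexed by $V$, $D(M)=\{v\in V:\operatorname{rank}(M\setminus\{v\})=\operatorname{rank} M\}$, where $M\setminus\{v\}$ is obtained by deleting row $v$ and column $v$. -}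

module Defs where

open import Data.Nat as ℕ using (ℕ; zero; suc)
open import Data.Fin using (Fin; zero; suc; _<_)
open import Data.Fin.Properties using (_≟_)
open import Data.Bool using (Bool; true; false; if_then_else_)
open import Data.Integer using (+_)
open import Data.Rational using (ℚ; 0ℚ; _+_; _*_; -_; _/_)
open import Data.Product using (Σ; ∃; _×_; _,_)
open import Data.Sum using (_⊎_)
open import Relation.Binary.PropositionalEquality using (_≡_; _≢_)
open import Relation.Nullary using (¬_; does)
open import Relation.Nullary.Decidable using (⌊_⌋)
open import Function.Definitions using (Injective)
import Data.Fin.Properties as FinP

Matrix : ℕ → Set
Matrix n = Fin n → Fin n → ℚ

Σℚ : (r : ℕ) → (Fin r → ℚ) → ℚ
Σℚ zero    f = 0ℚ
Σℚ (suc r) f = f zero + Σℚ r (λ j → f (suc j))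

ℕ→ℚ : ℕ → ℚ
ℕ→ℚ a = (+ a) / 1

record SimpleGraph (n : ℕ) : Set where
  field
    Adj   : Fin n → Fin n → Bool
    sym   : ∀ u v → Adj u v ≡ Adj v u
    irrfl : ∀ u → Adj u u ≡ false
open SimpleGraph public

-- An evaluation of the edge variables: x u v is the value of the variable of
-- edge {u,v} (only meaningful when {u,v} ∈ E); it must be symmetric.
Evaluation : ℕ → Set
Evaluation n = Fin n → Fin n → ℚ

IsEvaluation : ∀ {n} → Evaluation n → Set
IsEvaluation {n} x = ∀ (u v : Fin n) → x u v ≡ x v u

tutte : ∀ {n} → SimpleGraph n → Evaluation n → Matrix n
tutte G x u v =
  if Adj G u v
  then (if ⌊ FinP._<?_ u v ⌋ then x u v else - (x u v))
  else 0ℚ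

update : ∀ {n} → Evaluation n → Fin n → Fin n → ℚ → Evaluation n
update x p q a u v =
  if (⌊ u ≟ p ⌋ Data.Bool.∧ ⌊ v ≟ q ⌋) Data.Bool.∨ (⌊ u ≟ q ⌋ Data.Bool.∧ ⌊ v ≟ p ⌋)
  then a else x u v

-- Principal submatrix on an index set S ⊆ V: rows of M with indices in S
-- restricted to columns in S.  `rows` is a family of r distinct indices in S;
-- it is linearly independent if the only vanishing combination is trivial.
LinIndepOn : ∀ {n} → Matrix n → (Fin n → Set) → (r : ℕ) → (Fin r → Fin n) → Set
LinIndepOn {n} M S r rows =
  ∀ (c : Fin r → ℚ) →
    (∀ (col : Fin n) → S col → Σℚ r (λ j → c j * M (rows j) col) ≡ 0ℚ) →
    ∀ j → c j ≡ 0ℚ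

IndepFamilyOn : ∀ {n} → Matrix n → (Fin n → Set) → ℕ → Set
IndepFamilyOn {n} M S r =
  Σ (Fin r → Fin n) λ rows →
    Injective _≡_ _≡_ rows × (∀ j → S (rows j)) × LinIndepOn M S r rows

HasRankOn : ∀ {n} → Matrix n → (Fin n → Set) → ℕ → Set
HasRankOn M S k = IndepFamilyOn M S k × ¬ IndepFamilyOn M S (suc k)

All : ∀ {n} → Fin n → Set
All _ = Data.Unit.⊤
  where import Data.Unit

Minus : ∀ {n} → Fin n → Fin n → Set
Minus v w = w ≢ v

HasRank : ∀ {n} → Matrix n → ℕ → Set
HasRank M k = HasRankOn M All k

-- v ∈ D(M): rank (M ∖ {v}) = rank M
InD : ∀ {n} → Matrix n → Fin n → Set
InD M v = Σ ℕ λ k → HasRank M k × HasRankOn M (Minus v) k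

module Submission where

-- With every other variable fixed, the Tutte matrix is a pencil t ↦ M t = M 0 + t (e_p e_qᵀ − e_q e_pᵀ)
-- in the value t of x_{pq}, and M 0 is skew-symmetric.  A dependency c among some rows at t makes their
-- combination at any s equal to (s − t) times a vector of span(e_p, e_q), with coefficients the
-- "weights" (cᵀe_p, cᵀe_q).  Pairing two dependencies x, y at values t₁ ≠ t₂ through the skew form M 0
-- shows that their weight vectors are parallel; if the rows are independent at some s, suitable
-- combinations of x and y then force all products of their weights to vanish, so one of them has zero
-- weights and is a dependency at s itself, i.e. trivial.  Hence a family of rows independent at one
-- value of t is dependent for at most one value.  Rows witnessing rank k of T′_{x_i←a} on V ∖ {u}
-- are dependent at a_i since u ∉ D(T′), so they stay independent at every ã ≠ a_i; and a family of
-- k + 1 independent rows at ã would be dependent at both a and a_i.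

open import Defs hiding (sym)
open import Data.Nat using (ℕ; _≤_; _^_)
open import Data.Fin using (Fin; _<_)
open import Data.Bool using (true)
open import Data.Rational using (ℚ)
open import Relation.Binary.PropositionalEquality using (_≡_; _≢_)
open import Relation.Nullary using (¬_)

import Data.Nat as ℕ
import Data.Nat.Properties as ℕ
open import Data.Fin using (zero; suc)
open import Data.Fin.Properties using (_≟_; _<?_; <-irrefl; <-asym; <-cmp; suc-injective)
open import Data.Bool using (false; if_then_else_; _∧_; _∨_)
open import Data.Bool.Properties using (∧-comm; ∨-comm)
open import Data.Rational using (0ℚ; 1ℚ; _+_; _*_; -_; _-_; 1/_; ≢-nonZero)
import Data.Rational.Properties as ℚ
open import Data.Rational.Solver using (module +-*-Solver)
open import Algebra.Bundles using (CommutativeRing)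
open import Algebra.Properties.Semiring.Sum (CommutativeRing.semiring ℚ.+-*-commutativeRing)
  using (sum; sum-cong-≗; sum-replicate-zero; ∑-distrib-+; ∑-comm; *-distribˡ-sum)
open import Algebra.Properties.Group (CommutativeRing.+-group ℚ.+-*-commutativeRing)
  using (x∙y⁻¹≈ε⇒x≈y; ⁻¹-involutive)
open import Data.Product using (_×_; _,_; proj₁; proj₂)
open import Data.Sum using (_⊎_; inj₁; inj₂; [_,_])
import Data.Sum
open import Data.Unit using (tt)
open import Data.Vec.Functional using (_∷_)
open import Function using (_∘_)
open import Relation.Binary using (tri<; tri≈; tri>)
open import Relation.Nullary using (yes; no; contradiction)
open import Relation.Nullary.Decidable using (⌊_⌋; decidable-stable)
open import Relation.Binary.PropositionalEquality
  using (refl; sym; trans; cong; cong₂; subst; module ≡-Reasoning)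

open +-*-Solver

Σℚ≡sum : ∀ r (f : Fin r → ℚ) → Σℚ r f ≡ sum f
Σℚ≡sum ℕ.zero    f = refl
Σℚ≡sum (ℕ.suc r) f = cong (f zero +_) (Σℚ≡sum r (f ∘ suc))

Σℚ-cong : ∀ r {f g : Fin r → ℚ} → (∀ j → f j ≡ g j) → Σℚ r f ≡ Σℚ r g
Σℚ-cong r {f} {g} f≗g = trans (Σℚ≡sum r f) (trans (sum-cong-≗ f≗g) (sym (Σℚ≡sum r g)))

Σℚ-zero : ∀ r → Σℚ r (λ _ → 0ℚ) ≡ 0ℚ
Σℚ-zero r = trans (Σℚ≡sum r _) (sum-replicate-zero r)

Σℚ-* : ∀ r α (f : Fin r → ℚ) → Σℚ r (λ j → α * f j) ≡ α * Σℚ r f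
Σℚ-* r α f = begin
  Σℚ r (λ j → α * f j)  ≡⟨ Σℚ≡sum r _ ⟩
  sum (λ j → α * f j)   ≡⟨ sym (*-distribˡ-sum α f) ⟩
  α * sum f             ≡⟨ cong (α *_) (sym (Σℚ≡sum r f)) ⟩
  α * Σℚ r f            ∎
  where open ≡-Reasoning

Σℚ-linear : ∀ r α β (f g : Fin r → ℚ) →
            Σℚ r (λ j → α * f j + β * g j) ≡ α * Σℚ r f + β * Σℚ r g
Σℚ-linear r α β f g = begin
  Σℚ r (λ j → α * f j + β * g j)
    ≡⟨ Σℚ≡sum r _ ⟩
  sum (λ j → α * f j + β * g j)
    ≡⟨ ∑-distrib-+ (λ j → α * f j) (λ j → β * g j) ⟩
  sum (λ j → α * f j) + sum (λ j → β * g j)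
    ≡⟨ cong₂ _+_ (sym (Σℚ≡sum r _)) (sym (Σℚ≡sum r _)) ⟩
  Σℚ r (λ j → α * f j) + Σℚ r (λ j → β * g j)
    ≡⟨ cong₂ _+_ (Σℚ-* r α f) (Σℚ-* r β g) ⟩
  α * Σℚ r f + β * Σℚ r g
    ∎
  where open ≡-Reasoning

Σℚ-comm : ∀ r s (f : Fin r → Fin s → ℚ) →
          Σℚ r (λ i → Σℚ s (f i)) ≡ Σℚ s (λ j → Σℚ r (λ i → f i j))
Σℚ-comm r s f = begin
  Σℚ r (λ i → Σℚ s (f i))              ≡⟨ Σℚ-cong r (λ i → Σℚ≡sum s (f i)) ⟩
  Σℚ r (λ i → sum (f i))               ≡⟨ Σℚ≡sum r _ ⟩
  sum (λ i → sum (f i))                ≡⟨ ∑-comm f ⟩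
  sum (λ j → sum (λ i → f i j))        ≡⟨ sym (Σℚ≡sum s _) ⟩
  Σℚ s (λ j → sum (λ i → f i j))       ≡⟨ Σℚ-cong s (λ j → sym (Σℚ≡sum r _)) ⟩
  Σℚ s (λ j → Σℚ r (λ i → f i j))      ∎
  where open ≡-Reasoning

Σℚ-combination : ∀ r α β (x y h : Fin r → ℚ) →
  Σℚ r (λ j → (α * x j + β * y j) * h j) ≡
  α * Σℚ r (λ j → x j * h j) + β * Σℚ r (λ j → y j * h j)
Σℚ-combination r α β x y h =
  trans (Σℚ-cong r (λ j → distrib (x j) (y j) (h j)))
        (Σℚ-linear r α β (λ j → x j * h j) (λ j → y j * h j))
  where
  distrib : ∀ xj yj hj → (α * xj + β * yj) * hj ≡ α * (xj * hj) + β * (yj * hj)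
  distrib = solve 5 (λ α β x y h → (α :* x :+ β :* y) :* h := α :* (x :* h) :+ β :* (y :* h)) refl α β

p≢0∧p*q≡0⇒q≡0 : ∀ {p q} → p ≢ 0ℚ → p * q ≡ 0ℚ → q ≡ 0ℚ
p≢0∧p*q≡0⇒q≡0 {p} {q} p≢0 pq≡0 = begin
  q                  ≡⟨ sym (ℚ.*-identityˡ q) ⟩
  1ℚ * q             ≡⟨ cong (_* q) (sym (ℚ.*-inverseˡ p)) ⟩
  (1/ p * p) * q     ≡⟨ ℚ.*-assoc (1/ p) p q ⟩
  1/ p * (p * q)     ≡⟨ cong (1/ p *_) pq≡0 ⟩
  1/ p * 0ℚ          ≡⟨ ℚ.*-zeroʳ (1/ p) ⟩
  0ℚ                 ∎
  where
  open ≡-Reasoning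
  instance _ = ≢-nonZero p≢0

p≢q∧[p-q]*r≡0⇒r≡0 : ∀ {p q r} → p ≢ q → (p - q) * r ≡ 0ℚ → r ≡ 0ℚ
p≢q∧[p-q]*r≡0⇒r≡0 p≢q = p≢0∧p*q≡0⇒q≡0 (p≢q ∘ x∙y⁻¹≈ε⇒x≈y _ _)

c≡0⇒r≡r+t*c : ∀ {r c} t → c ≡ 0ℚ → r ≡ r + t * c
c≡0⇒r≡r+t*c {r} t refl = solve 2 (λ r t → r := r :+ t :* con 0ℚ) refl r t

outer-product≡0⇒zero : ∀ {a b c d} → a * c ≡ 0ℚ → a * d ≡ 0ℚ → b * c ≡ 0ℚ → b * d ≡ 0ℚ →
                       (a ≡ 0ℚ × b ≡ 0ℚ) ⊎ (c ≡ 0ℚ × d ≡ 0ℚ)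
outer-product≡0⇒zero {a} {b} ac≡0 ad≡0 bc≡0 bd≡0 with a ℚ.≟ 0ℚ | b ℚ.≟ 0ℚ
... | yes a≡0 | yes b≡0 = inj₁ (a≡0 , b≡0)
... | no a≢0  | _       = inj₂ (p≢0∧p*q≡0⇒q≡0 a≢0 ac≡0 , p≢0∧p*q≡0⇒q≡0 a≢0 ad≡0)
... | yes _   | no b≢0  = inj₂ (p≢0∧p*q≡0⇒q≡0 b≢0 bc≡0 , p≢0∧p*q≡0⇒q≡0 b≢0 bd≡0)

module _ {a b c d : ℚ} (ad≡bc : a * d ≡ b * c) (u v : ℚ) where
  open ≡-Reasoning

  ad≡bc⇒c[au-bv]≡a[cu-dv] : c * (a * u - b * v) ≡ a * (c * u - d * v)
  ad≡bc⇒c[au-bv]≡a[cu-dv] = begin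
    c * (a * u - b * v)
      ≡⟨ solve 5 (λ a b c u v → c :* (a :* u :- b :* v) := a :* c :* u :- b :* c :* v) refl a b c u v ⟩
    a * c * u - b * c * v
      ≡⟨ cong (λ z → a * c * u - z * v) (sym ad≡bc) ⟩
    a * c * u - a * d * v
      ≡⟨ solve 5 (λ a c d u v → a :* c :* u :- a :* d :* v := a :* (c :* u :- d :* v)) refl a c d u v ⟩
    a * (c * u - d * v)
      ∎

  ad≡bc⇒d[au-bv]≡b[cu-dv] : d * (a * u - b * v) ≡ b * (c * u - d * v)
  ad≡bc⇒d[au-bv]≡b[cu-dv] = begin
    d * (a * u - b * v)
      ≡⟨ solve 5 (λ a b d u v → d :* (a :* u :- b :* v) := a :* d :* u :- b :* d :* v) refl a b d u v ⟩
    a * d * u - b * d * v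
      ≡⟨ cong (λ z → z * u - b * d * v) ad≡bc ⟩
    b * c * u - b * d * v
      ≡⟨ solve 5 (λ b c d u v → b :* c :* u :- b :* d :* v := b :* (c :* u :- d :* v)) refl b c d u v ⟩
    b * (c * u - d * v)
      ∎

module _ {n : ℕ} {M : Matrix n} {S : Fin n → Set} where

  LinIndepOn-stable : ∀ {r rows} →
    (∀ c → (∀ w → S w → Σℚ r (λ j → c j * M (rows j) w) ≡ 0ℚ) → ∀ j → ¬ c j ≢ 0ℚ) →
    LinIndepOn M S r rows
  LinIndepOn-stable ¬¬c≡0 c kills j = decidable-stable (c j ℚ.≟ 0ℚ) (¬¬c≡0 c kills j)

  IndepFamilyOn-⊆ : ∀ {S′ r} → (∀ w → S w → S′ w) → IndepFamilyOn M S r → IndepFamilyOn M S′ r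
  IndepFamilyOn-⊆ S⊆S′ (rows , inj , rows∈S , ind) =
    rows , inj , S⊆S′ _ ∘ rows∈S , λ c kills → ind c (λ w → kills w ∘ S⊆S′ w)

  IndepFamilyOn-tail : ∀ {r} → IndepFamilyOn M S (ℕ.suc r) → IndepFamilyOn M S r
  IndepFamilyOn-tail {r} (rows , inj , rows∈S , ind) =
    rows ∘ suc , suc-injective ∘ inj , rows∈S ∘ suc ,
    λ c kills j → ind (0ℚ ∷ c) (kills-with-zero-head c kills) (suc j)
    where
    kills-with-zero-head : ∀ c → (∀ w → S w → Σℚ r (λ j → c j * M (rows (suc j)) w) ≡ 0ℚ) →
                           ∀ w → S w → Σℚ (ℕ.suc r) (λ j → (0ℚ ∷ c) j * M (rows j) w) ≡ 0ℚ
    kills-with-zero-head c kills w w∈S =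
      trans (cong (_+ Σℚ r (λ j → c j * M (rows (suc j)) w)) (ℚ.*-zeroˡ (M (rows zero) w)))
            (trans (ℚ.+-identityˡ _) (kills w w∈S))

  IndepFamilyOn-mono : ∀ {r r′} → r ≤ r′ → IndepFamilyOn M S r′ → IndepFamilyOn M S r
  IndepFamilyOn-mono = go ∘ ℕ.≤⇒≤′
    where
    go : ∀ {r r′} → r ℕ.≤′ r′ → IndepFamilyOn M S r′ → IndepFamilyOn M S r
    go (ℕ.≤′-reflexive refl) = λ ind → ind
    go (ℕ.≤′-step r≤r′)      = go r≤r′ ∘ IndepFamilyOn-tail

  HasRankOn-unique : ∀ {k k′} → HasRankOn M S k → HasRankOn M S k′ → k ≡ k′
  HasRankOn-unique (ind , maximal) (ind′ , maximal′) =
    ℕ.≤-antisym (≤-rank ind maximal′) (≤-rank ind′ maximal)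
    where
    ≤-rank : ∀ {r s} → IndepFamilyOn M S r → ¬ IndepFamilyOn M S (ℕ.suc s) → r ≤ s
    ≤-rank {r} {s} ind ¬ind with r ℕ.≤? s
    ... | yes r≤s = r≤s
    ... | no  r≰s = contradiction (IndepFamilyOn-mono (ℕ.≰⇒> r≰s) ind) ¬ind

IndepFamilyOn-cong : ∀ {n} {M M′ : Matrix n} {S r} →
  (∀ v w → M v w ≡ M′ v w) → IndepFamilyOn M S r → IndepFamilyOn M′ S r
IndepFamilyOn-cong {r = r} M≗M′ (rows , inj , rows∈S , ind) =
  rows , inj , rows∈S ,
  λ c kills → ind c (λ w w∈S → trans (Σℚ-cong r (λ j → cong (c j *_) (M≗M′ (rows j) w))) (kills w w∈S))

module SkewRankTwoPencil {n : ℕ} (M : ℚ → Matrix n) (e f : Fin n → ℚ)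
  (M-pencil : ∀ t v w → M t v w ≡ M 0ℚ v w + t * (e v * f w - f v * e w))
  (M₀-skew : ∀ v w → M 0ℚ v w ≡ - M 0ℚ w v) where

  module Rows (S : Fin n → Set) {m : ℕ} (rows : Fin m → Fin n) (rows∈S : ∀ j → S (rows j)) where

    open ≡-Reasoning

    rowComb : (Fin m → ℚ) → ℚ → Fin n → ℚ
    rowComb c t w = Σℚ m (λ j → c j * M t (rows j) w)

    Kills : (Fin m → ℚ) → ℚ → Set
    Kills c t = ∀ w → S w → rowComb c t w ≡ 0ℚ

    weight : (Fin n → ℚ) → (Fin m → ℚ) → ℚ
    weight g c = Σℚ m (λ j → c j * g (rows j))

    residual : (Fin m → ℚ) → Fin n → ℚ
    residual c w = weight e c * f w - weight f c * e w

    rowComb-pencil : ∀ c t w → rowComb c t w ≡ rowComb c 0ℚ w + t * residual c w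
    rowComb-pencil c t w = begin
      rowComb c t w
        ≡⟨ Σℚ-cong m (λ j → trans (cong (c j *_) (M-pencil t (rows j) w))
                                  (expand (c j) (M 0ℚ (rows j) w) (e (rows j)) (f (rows j)))) ⟩
      Σℚ m (λ j → 1ℚ * (c j * M 0ℚ (rows j) w) + t * (f w * (c j * e (rows j)) + (- e w) * (c j * f (rows j))))
        ≡⟨ Σℚ-linear m 1ℚ t _ _ ⟩
      1ℚ * rowComb c 0ℚ w + t * Σℚ m (λ j → f w * (c j * e (rows j)) + (- e w) * (c j * f (rows j)))
        ≡⟨ cong (λ z → 1ℚ * rowComb c 0ℚ w + t * z) (Σℚ-linear m (f w) (- e w) _ _) ⟩
      1ℚ * rowComb c 0ℚ w + t * (f w * weight e c + (- e w) * weight f c)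
        ≡⟨ solve 6 (λ R t fw ew pc qc → con 1ℚ :* R :+ t :* (fw :* pc :+ (:- ew) :* qc)
                                        := R :+ t :* (pc :* fw :- qc :* ew))
                 refl (rowComb c 0ℚ w) t (f w) (e w) (weight e c) (weight f c) ⟩
      rowComb c 0ℚ w + t * residual c w
        ∎
      where
      expand : ∀ cj m₀ ej fj → cj * (m₀ + t * (ej * f w - fj * e w)) ≡
                              1ℚ * (cj * m₀) + t * (f w * (cj * ej) + (- e w) * (cj * fj))
      expand cj m₀ ej fj =
        solve 7 (λ cj m₀ ej fj t fw ew → cj :* (m₀ :+ t :* (ej :* fw :- fj :* ew))
                   := con 1ℚ :* (cj :* m₀) :+ t :* (fw :* (cj :* ej) :+ (:- ew) :* (cj :* fj)))
          refl cj m₀ ej fj t (f w) (e w)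

    Kills⇒rowComb : ∀ {c t} → Kills c t → ∀ s w → S w → rowComb c s w ≡ (s - t) * residual c w
    Kills⇒rowComb {c} {t} kills s w w∈S = begin
      rowComb c s w
        ≡⟨ rowComb-pencil c s w ⟩
      R₀ + s * ρ
        ≡⟨ solve 4 (λ R₀ ρ s t → R₀ :+ s :* ρ := (R₀ :+ t :* ρ) :+ (s :- t) :* ρ) refl R₀ ρ s t ⟩
      (R₀ + t * ρ) + (s - t) * ρ
        ≡⟨ cong (_+ (s - t) * ρ) (trans (sym (rowComb-pencil c t w)) (kills w w∈S)) ⟩
      0ℚ + (s - t) * ρ
        ≡⟨ ℚ.+-identityˡ _ ⟩
      (s - t) * ρ
        ∎
      where
      R₀ = rowComb c 0ℚ w
      ρ  = residual c w

    pairing : (Fin m → ℚ) → (Fin m → ℚ) → ℚ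
    pairing c d = Σℚ m (λ j → d j * rowComb c 0ℚ (rows j))

    pairing-antisym : ∀ c d → pairing c d ≡ - pairing d c
    pairing-antisym c d = begin
      Σℚ m (λ j → d j * Σℚ m (λ i → c i * M₀ i j))
        ≡⟨ Σℚ-cong m (λ j → sym (Σℚ-* m (d j) _)) ⟩
      Σℚ m (λ j → Σℚ m (λ i → d j * (c i * M₀ i j)))
        ≡⟨ Σℚ-comm m m _ ⟩
      Σℚ m (λ i → Σℚ m (λ j → d j * (c i * M₀ i j)))
        ≡⟨ Σℚ-cong m (λ i → Σℚ-cong m (swap-skew i)) ⟩
      Σℚ m (λ i → Σℚ m (λ j → - 1ℚ * (c i * (d j * M₀ j i))))
        ≡⟨ Σℚ-cong m (λ i → Σℚ-* m (- 1ℚ) _) ⟩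
      Σℚ m (λ i → - 1ℚ * Σℚ m (λ j → c i * (d j * M₀ j i)))
        ≡⟨ Σℚ-* m (- 1ℚ) _ ⟩
      - 1ℚ * Σℚ m (λ i → Σℚ m (λ j → c i * (d j * M₀ j i)))
        ≡⟨ cong (- 1ℚ *_) (Σℚ-cong m (λ i → Σℚ-* m (c i) _)) ⟩
      - 1ℚ * pairing d c
        ≡⟨ solve 1 (λ P → :- con 1ℚ :* P := :- P) refl (pairing d c) ⟩
      - pairing d c
        ∎
      where
      M₀ : Fin m → Fin m → ℚ
      M₀ i j = M 0ℚ (rows i) (rows j)
      swap-skew : ∀ i j → d j * (c i * M₀ i j) ≡ - 1ℚ * (c i * (d j * M₀ j i))
      swap-skew i j =
        trans (cong (λ z → d j * (c i * z)) (M₀-skew (rows i) (rows j)))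
              (solve 3 (λ dj ci z → dj :* (ci :* (:- z)) := :- con 1ℚ :* (ci :* (dj :* z)))
                     refl (d j) (c i) (M₀ j i))

    Kills⇒pairing : ∀ {c t} → Kills c t → ∀ d →
                    pairing c d ≡ (0ℚ - t) * (weight e c * weight f d - weight f c * weight e d)
    Kills⇒pairing {c} {t} kills d = begin
      Σℚ m (λ j → d j * rowComb c 0ℚ (rows j))
        ≡⟨ Σℚ-cong m (λ j → trans (cong (d j *_) (Kills⇒rowComb {c} {t} kills 0ℚ (rows j) (rows∈S j)))
                                  (regroup (d j) (f (rows j)) (e (rows j)))) ⟩
      Σℚ m (λ j → α * (d j * f (rows j)) + β * (d j * e (rows j)))
        ≡⟨ Σℚ-linear m α β (λ j → d j * f (rows j)) (λ j → d j * e (rows j)) ⟩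
      α * weight f d + β * weight e d
        ≡⟨ solve 5 (λ τ pc qc qd pd → τ :* pc :* qd :+ (:- (τ :* qc)) :* pd := τ :* (pc :* qd :- qc :* pd))
                 refl (0ℚ - t) (weight e c) (weight f c) (weight f d) (weight e d) ⟩
      (0ℚ - t) * (weight e c * weight f d - weight f c * weight e d)
        ∎
      where
      α = (0ℚ - t) * weight e c
      β = - ((0ℚ - t) * weight f c)
      regroup : ∀ dj fj ej → dj * ((0ℚ - t) * (weight e c * fj - weight f c * ej)) ≡ α * (dj * fj) + β * (dj * ej)
      regroup dj fj ej = solve 6 (λ dj fj ej τ pc qc → dj :* (τ :* (pc :* fj :- qc :* ej))
                                    := (τ :* pc) :* (dj :* fj) :+ (:- (τ :* qc)) :* (dj :* ej))
                           refl dj fj ej (0ℚ - t) (weight e c) (weight f c)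

    -- By antisymmetry the pairings of x with y and of y with x cancel, which leaves
    -- (t₂ − t₁) (pₓ q_y − qₓ p_y) = 0.
    weights-parallel : ∀ {x y t₁ t₂} → t₁ ≢ t₂ → Kills x t₁ → Kills y t₂ →
                       weight e x * weight f y ≡ weight f x * weight e y
    weights-parallel {x} {y} {t₁} {t₂} t₁≢t₂ kills₁ kills₂ =
      x∙y⁻¹≈ε⇒x≈y _ _ (p≢q∧[p-q]*r≡0⇒r≡0 (t₁≢t₂ ∘ sym) (begin
        (t₂ - t₁) * (px * qy - qx * py)
          ≡⟨ solve 6 (λ t₁ t₂ px qx py qy → (t₂ :- t₁) :* (px :* qy :- qx :* py)
                       := (con 0ℚ :- t₁) :* (px :* qy :- qx :* py) :+ (con 0ℚ :- t₂) :* (py :* qx :- qy :* px))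
                   refl t₁ t₂ px qx py qy ⟩
        (0ℚ - t₁) * (px * qy - qx * py) + (0ℚ - t₂) * (py * qx - qy * px)
          ≡⟨ sym (cong₂ _+_ (Kills⇒pairing {x} {t₁} kills₁ y) (Kills⇒pairing {y} {t₂} kills₂ x)) ⟩
        pairing x y + pairing y x
          ≡⟨ cong (_+ pairing y x) (pairing-antisym x y) ⟩
        - pairing y x + pairing y x
          ≡⟨ ℚ.+-inverseˡ (pairing y x) ⟩
        0ℚ ∎))
      where
      px = weight e x
      qx = weight f x
      py = weight e y
      qy = weight f y

    module _ {s : ℚ} (ind : LinIndepOn (M s) S m rows) where

      combination-weights : ∀ α β x y → (∀ w → S w → α * rowComb x s w + β * rowComb y s w ≡ 0ℚ) →
                            ∀ g → α * weight g x + β * weight g y ≡ 0ℚ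
      combination-weights α β x y kills g = begin
        α * weight g x + β * weight g y
          ≡⟨ sym (Σℚ-combination m α β x y (g ∘ rows)) ⟩
        Σℚ m (λ j → z j * g (rows j))
          ≡⟨ Σℚ-cong m (λ j → trans (cong (_* g (rows j)) (z≡0 j)) (ℚ.*-zeroˡ (g (rows j)))) ⟩
        Σℚ m (λ _ → 0ℚ)
          ≡⟨ Σℚ-zero m ⟩
        0ℚ
          ∎
        where
        z : Fin m → ℚ
        z j = α * x j + β * y j
        z≡0 : ∀ j → z j ≡ 0ℚ
        z≡0 = ind z (λ w w∈S → trans (Σℚ-combination m α β x y (λ j → M s (rows j) w)) (kills w w∈S))

      vanishing-weights⇒trivial : ∀ {c t} → Kills c t → weight e c ≡ 0ℚ → weight f c ≡ 0ℚ →
                                  ∀ j → c j ≡ 0ℚ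
      vanishing-weights⇒trivial {c} {t} kills pc≡0 qc≡0 = ind c λ w w∈S → begin
        rowComb c s w
          ≡⟨ Kills⇒rowComb {c} {t} kills s w w∈S ⟩
        (s - t) * (weight e c * f w - weight f c * e w)
          ≡⟨ cong₂ (λ p q → (s - t) * (p * f w - q * e w)) pc≡0 qc≡0 ⟩
        (s - t) * (0ℚ * f w - 0ℚ * e w)
          ≡⟨ solve 3 (λ τ fw ew → τ :* (con 0ℚ :* fw :- con 0ℚ :* ew) := con 0ℚ) refl (s - t) (f w) (e w) ⟩
        0ℚ
          ∎

      -- The combination (s − t₂) α x − (s − t₁) β y of the rows at s is (s − t₁)(s − t₂)(α ρₓ − β ρ_y),
      -- which vanishes; applying a weight to the resulting linear relation between x and y, and choosing
      -- (α, β) = (p_y, pₓ) or (q_y, qₓ), shows that all four products of weights of x and y vanish.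
      Kills-twice⇒trivial : ∀ {x y t₁ t₂} → t₁ ≢ t₂ → Kills x t₁ → Kills y t₂ →
                            (∀ j → x j ≡ 0ℚ) ⊎ (∀ j → y j ≡ 0ℚ)
      Kills-twice⇒trivial {x} {y} {t₁} {t₂} t₁≢t₂ kills₁ kills₂ =
        Data.Sum.map (λ (px≡0 , qx≡0) → vanishing-weights⇒trivial {x} {t₁} kills₁ px≡0 qx≡0)
                     (λ (py≡0 , qy≡0) → vanishing-weights⇒trivial {y} {t₂} kills₂ py≡0 qy≡0)
                     (outer-product≡0⇒zero px*py≡0 px*qy≡0 qx*py≡0 qx*qy≡0)
        where
        px = weight e x
        qx = weight f x
        py = weight e y
        qy = weight f y

        parallel : px * qy ≡ qx * py
        parallel = weights-parallel {x} {y} t₁≢t₂ kills₁ kills₂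

        cancel : ∀ {u} → (s - t₂) * u ≡ (s - t₁) * u → u ≡ 0ℚ
        cancel {u} eq = p≢q∧[p-q]*r≡0⇒r≡0 t₁≢t₂ (begin
          (t₁ - t₂) * u
            ≡⟨ solve 4 (λ s t₁ t₂ u → (t₁ :- t₂) :* u := (s :- t₂) :* u :- (s :- t₁) :* u) refl s t₁ t₂ u ⟩
          (s - t₂) * u - (s - t₁) * u
            ≡⟨ cong (_- (s - t₁) * u) eq ⟩
          (s - t₁) * u - (s - t₁) * u
            ≡⟨ ℚ.+-inverseʳ ((s - t₁) * u) ⟩
          0ℚ
            ∎)

        proportional-residuals : ∀ α β → (∀ w → S w → α * residual x w ≡ β * residual y w) →
                                 ∀ g → (s - t₂) * (α * weight g x) ≡ (s - t₁) * (β * weight g y)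
        proportional-residuals α β αρx≡βρy g = x∙y⁻¹≈ε⇒x≈y _ _ (trans
          (solve 6 (λ a b α β wx wy → b :* (α :* wx) :- a :* (β :* wy) := b :* α :* wx :+ (:- (a :* β)) :* wy)
                 refl (s - t₁) (s - t₂) α β (weight g x) (weight g y))
          (combination-weights ((s - t₂) * α) (- ((s - t₁) * β)) x y kills g))
          where
          κ = (s - t₁) * (s - t₂)
          kills : ∀ w → S w → (s - t₂) * α * rowComb x s w + (- ((s - t₁) * β)) * rowComb y s w ≡ 0ℚ
          kills w w∈S = begin
            (s - t₂) * α * rowComb x s w + (- ((s - t₁) * β)) * rowComb y s w
              ≡⟨ cong₂ (λ X Y → (s - t₂) * α * X + (- ((s - t₁) * β)) * Y)
                       (Kills⇒rowComb {x} {t₁} kills₁ s w w∈S) (Kills⇒rowComb {y} {t₂} kills₂ s w w∈S) ⟩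
            (s - t₂) * α * ((s - t₁) * residual x w) + (- ((s - t₁) * β)) * ((s - t₂) * residual y w)
              ≡⟨ solve 6 (λ a b α β ρx ρy → b :* α :* (a :* ρx) :+ (:- (a :* β)) :* (b :* ρy)
                                            := (a :* b) :* (α :* ρx :- β :* ρy))
                       refl (s - t₁) (s - t₂) α β (residual x w) (residual y w) ⟩
            κ * (α * residual x w - β * residual y w)
              ≡⟨ cong (λ z → κ * (z - β * residual y w)) (αρx≡βρy w w∈S) ⟩
            κ * (β * residual y w - β * residual y w)
              ≡⟨ cong (κ *_) (ℚ.+-inverseʳ (β * residual y w)) ⟩
            κ * 0ℚ
              ≡⟨ ℚ.*-zeroʳ κ ⟩
            0ℚ
              ∎

        pyρx≡pxρy : ∀ w → S w → py * residual x w ≡ px * residual y w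
        pyρx≡pxρy w _ = ad≡bc⇒c[au-bv]≡a[cu-dv] {px} {qx} {py} {qy} parallel (f w) (e w)

        qyρx≡qxρy : ∀ w → S w → qy * residual x w ≡ qx * residual y w
        qyρx≡qxρy w _ = ad≡bc⇒d[au-bv]≡b[cu-dv] {px} {qx} {py} {qy} parallel (f w) (e w)

        px*py≡0 : px * py ≡ 0ℚ
        px*py≡0 = cancel (trans (cong ((s - t₂) *_) (ℚ.*-comm px py)) (proportional-residuals py px pyρx≡pxρy e))

        qx*qy≡0 : qx * qy ≡ 0ℚ
        qx*qy≡0 = cancel (trans (cong ((s - t₂) *_) (ℚ.*-comm qx qy)) (proportional-residuals qy qx qyρx≡qxρy f))

        qx*py≡0 : qx * py ≡ 0ℚ
        qx*py≡0 = cancel (trans (cong ((s - t₂) *_) (ℚ.*-comm qx py))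
                                (trans (proportional-residuals py px pyρx≡pxρy f) (cong ((s - t₁) *_) parallel)))

        px*qy≡0 : px * qy ≡ 0ℚ
        px*qy≡0 = trans parallel qx*py≡0

  IndepFamilyOn-except-one : ∀ {S r s t₁ t₂} → IndepFamilyOn (M s) S r → t₁ ≢ t₂ →
                             ¬ IndepFamilyOn (M t₂) S r → IndepFamilyOn (M t₁) S r
  IndepFamilyOn-except-one {S} {t₁ = t₁} {t₂ = t₂} (rows , inj , rows∈S , ind) t₁≢t₂ ¬ind₂ =
    rows , inj , rows∈S , LinIndepOn-stable {M = M t₁} {rows = rows} λ x kills₁ j x≢0 →
      ¬ind₂ (rows , inj , rows∈S , LinIndepOn-stable {M = M t₂} {rows = rows} λ y kills₂ j′ y≢0 →
        [ (λ x≡0 → x≢0 (x≡0 j)) , (λ y≡0 → y≢0 (y≡0 j′)) ]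
          (Kills-twice⇒trivial ind {x} {y} t₁≢t₂ kills₁ kills₂))
    where open Rows S rows rows∈S

δ : ∀ {n} → Fin n → Fin n → ℚ
δ v w = if ⌊ v ≟ w ⌋ then 1ℚ else 0ℚ

module _ {n : ℕ} (G : SimpleGraph n) where

  tutte-cong : ∀ {y y′ : Evaluation n} → (∀ v w → y v w ≡ y′ v w) →
               ∀ v w → tutte G y v w ≡ tutte G y′ v w
  tutte-cong y≗y′ v w =
    cong (λ z → if Adj G v w then (if ⌊ v <? w ⌋ then z else - z) else 0ℚ) (y≗y′ v w)

  tutte-skew : ∀ {y} → IsEvaluation y → ∀ v w → tutte G y v w ≡ - tutte G y w v
  tutte-skew {y} y-sym v w rewrite SimpleGraph.sym G w v | y-sym w v
    with Adj G v w in vw∈E | v <? w | w <? v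
  ... | false | _       | _       = refl
  ... | true  | yes v<w | yes w<v = contradiction w<v (<-asym v<w)
  ... | true  | yes _   | no _    = sym (⁻¹-involutive (y v w))
  ... | true  | no _    | yes _   = refl
  ... | true  | no v≮w  | no w≮v  with <-cmp v w
  ...   | tri< v<w _ _  = contradiction v<w v≮w
  ...   | tri≈ _ refl _ = contradiction (trans (sym vw∈E) (irrfl G v)) λ ()
  ...   | tri> _ _ w<v  = contradiction w<v w≮v

module TuttePencil {n : ℕ} (G : SimpleGraph n) {x : Evaluation n} (x-sym : IsEvaluation x)
                   {p q : Fin n} (p<q : p < q) (pq∈E : Adj G p q ≡ true) where

  M : ℚ → Matrix n
  M t = tutte G (update x p q t)

  p≢q : p ≢ q
  p≢q p≡q = <-irrefl p≡q p<q

  update-sym : ∀ t → IsEvaluation (update x p q t)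
  update-sym t v w =
    cong₂ (λ b z → if b then t else z) (swap-condition ⌊ v ≟ p ⌋ ⌊ w ≟ q ⌋ ⌊ v ≟ q ⌋ ⌊ w ≟ p ⌋) (x-sym v w)
    where
    swap-condition : ∀ a b c d → (a ∧ b) ∨ (c ∧ d) ≡ (d ∧ c) ∨ (b ∧ a)
    swap-condition a b c d rewrite ∧-comm a b | ∧-comm c d = ∨-comm (b ∧ a) (d ∧ c)

  update-self : ∀ v w → update x p q (x p q) v w ≡ x v w
  update-self v w with v ≟ p | w ≟ q | v ≟ q | w ≟ p
  ... | yes refl | yes refl | _        | _        = refl
  ... | yes v≡p  | no _     | yes v≡q  | _        = contradiction (trans (sym v≡p) v≡q) p≢q
  ... | yes _    | no _     | no _     | _        = refl
  ... | no _     | _        | yes refl | yes refl = x-sym p q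
  ... | no _     | _        | yes _    | no _     = refl
  ... | no _     | _        | no _     | _        = refl

  M-at-value : ∀ v w → M (x p q) v w ≡ tutte G x v w
  M-at-value = tutte-cong G update-self

  M-pencil : ∀ t v w → M t v w ≡ M 0ℚ v w + t * (δ v p * δ w q - δ v q * δ w p)
  M-pencil t v w with Adj G v w in vw∈E | v <? w | v ≟ p | w ≟ q | v ≟ q | w ≟ p
  ... | _     | _       | yes v≡p  | _        | yes v≡q  | _        = contradiction (trans (sym v≡p) v≡q) p≢q
  ... | _     | _       | _        | yes w≡q  | _        | yes w≡p  = contradiction (trans (sym w≡p) w≡q) p≢q
  ... | false | _       | yes refl | yes refl | _        | _        = contradiction (trans (sym vw∈E) pq∈E) λ ()
  ... | true  | no p≮q  | yes refl | yes refl | _        | _        = contradiction p<q p≮q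
  ... | true  | yes _   | yes refl | yes refl | no _     | no _     =
    solve 1 (λ t → t := con 0ℚ :+ t :* (con 1ℚ :* con 1ℚ :- con 0ℚ :* con 0ℚ)) refl t
  ... | false | _       | no _     | _        | yes refl | yes refl =
    contradiction (trans (sym vw∈E) (trans (SimpleGraph.sym G q p) pq∈E)) λ ()
  ... | true  | yes q<p | no _     | _        | yes refl | yes refl = contradiction q<p (<-asym p<q)
  ... | true  | no _    | no _     | no _     | yes refl | yes refl =
    solve 1 (λ t → :- t := :- con 0ℚ :+ t :* (con 0ℚ :* con 0ℚ :- con 1ℚ :* con 1ℚ)) refl t
  ... | _     | _       | yes _    | no _     | no _     | wp       =
    c≡0⇒r≡r+t*c t (solve 1 (λ δwp → con 1ℚ :* con 0ℚ :- con 0ℚ :* δwp := con 0ℚ) refl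
                           (if ⌊ wp ⌋ then 1ℚ else 0ℚ))
  ... | _     | _       | no _     | wq       | no _     | wp       =
    c≡0⇒r≡r+t*c t (solve 2 (λ δwq δwp → con 0ℚ :* δwq :- con 0ℚ :* δwp := con 0ℚ) refl
                           (if ⌊ wq ⌋ then 1ℚ else 0ℚ) (if ⌊ wp ⌋ then 1ℚ else 0ℚ))
  ... | _     | _       | no _     | wq       | yes _    | no _     =
    c≡0⇒r≡r+t*c t (solve 1 (λ δwq → con 0ℚ :* δwq :- con 1ℚ :* con 0ℚ := con 0ℚ) refl
                           (if ⌊ wq ⌋ then 1ℚ else 0ℚ))

  open SkewRankTwoPencil M (λ v → δ v p) (λ v → δ v q) M-pencil (tutte-skew G (update-sym 0ℚ))
    public using (IndepFamilyOn-except-one)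

lemma3p6 : (n : ℕ) (G : SimpleGraph n) (x : Evaluation n) → IsEvaluation x →
    (p q : Fin n) → p < q → Adj G p q ≡ true →
    (a : ℕ) → 1 ≤ a → a ≤ n ^ 10 →
    (k : ℕ) → HasRank (tutte G (update x p q (ℕ→ℚ a))) k → HasRank (tutte G x) k →
    (u : Fin n) → InD (tutte G (update x p q (ℕ→ℚ a))) u → ¬ InD (tutte G x) u →
    (ã : ℚ) → ã ≢ x p q → InD (tutte G (update x p q ã)) u
lemma3p6 n G x x-sym p q p<q pq∈E a _ _ k rank-a rank-x u (k′ , rank-a′ , rank-a-u′) u∉Dx ã ã≢xpq =
  k , (forget-u {M ã} indep-ã-u , no-larger) , (indep-ã-u , no-larger ∘ forget-u {M ã})
  where
  open TuttePencil G x-sym p<q pq∈E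

  forget-u : ∀ {N : Matrix n} {r} → IndepFamilyOn N (Minus u) r → IndepFamilyOn N All r
  forget-u {N} = IndepFamilyOn-⊆ {M = N} {S = Minus u} (λ _ _ → tt)

  a′ : ℚ
  a′ = ℕ→ℚ a

  rank-a-u : HasRankOn (M a′) (Minus u) k
  rank-a-u = subst (HasRankOn (M a′) (Minus u)) (HasRankOn-unique {M = M a′} {S = All} rank-a′ rank-a) rank-a-u′

  ¬indep-u : ¬ IndepFamilyOn (M (x p q)) (Minus u) k
  ¬indep-u ind = u∉Dx (k , rank-x , IndepFamilyOn-cong M-at-value ind , proj₂ rank-x ∘ forget-u {tutte G x})

  a′≢xpq : a′ ≢ x p q
  a′≢xpq a′≡xpq = ¬indep-u (subst (λ t → IndepFamilyOn (M t) (Minus u) k) a′≡xpq (proj₁ rank-a-u))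

  indep-ã-u : IndepFamilyOn (M ã) (Minus u) k
  indep-ã-u = IndepFamilyOn-except-one (proj₁ rank-a-u) ã≢xpq ¬indep-u

  no-larger : ¬ IndepFamilyOn (M ã) All (ℕ.suc k)
  no-larger ind = proj₂ rank-a (IndepFamilyOn-except-one ind a′≢xpq (proj₂ rank-x ∘ IndepFamilyOn-cong M-at-value))
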